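{- For every positive integer $k$ and every real $\delta>0$, there exists a multiset of deadlines $D$ with $\mathrm{Dens}(D)>\delta$ that admits a $k$-Visits schedule. Equivalently, $k$-Visits has no upper density threshold, for any $k$.
   Context: $k$-Visits: given a multiset of positive integers (deadlines) $D=\{d_1,\ldots,d_n\}$, a $k$-Visits schedule is a sequence of length $nk$ with entries in $[n]$, containing each $i$ exactly $k$ times, such that the first occurrence of $i$ is within the first $d_i$ positions and every later occurrence of $i$ is at most $d_i$ positions after the previous one. The density of $D$ is $\mathrm{Dens}(D)=\sum_i 1/d_i$. The upper density threshold of a problem is the smallest value above which no instance admits a schedule.
   Formalization: The parameter δ ranges over the positive rationals instead of the positive reals. -}

module Defs where

open import Data.Nat using (ℕ; zero; suc; _+_; _*_; _≤_; _<_)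
open import Data.Fin using (Fin; toℕ)
import Data.Fin as F
open import Data.Fin.Properties using (_≟_)
open import Data.List using (List; length; filter)
open import Data.List using (allFin) public
open import Data.Rational using (ℚ; 0ℚ; _/_)
import Data.Rational as ℚ
open import Data.Integer using (+_)
open import Data.Product using (_×_; ∃)
open import Relation.Binary.PropositionalEquality using (_≡_)
open import Relation.Nullary using (¬_)

-- Reciprocal of a deadline; deadlines are required to be positive
-- (the value at 0 is irrelevant and set to 0).
inv : ℕ → ℚ
inv zero = 0ℚ
inv (suc m) = + 1 / suc m

sumFin : (n : ℕ) → (Fin n → ℚ) → ℚ
sumFin zero f = 0ℚ
sumFin (suc n) f = f F.zero ℚ.+ sumFin n (λ i → f (F.suc i))

-- A multiset of n deadlines is a function d : Fin n → ℕ (all d i ≥ 1).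
Positive : (n : ℕ) → (Fin n → ℕ) → Set
Positive n d = ∀ i → 1 ≤ d i

Dens : (n : ℕ) → (Fin n → ℕ) → ℚ
Dens n d = sumFin n (λ i → inv (d i))

count : {n m : ℕ} → (Fin m → Fin n) → Fin n → ℕ
count {m = m} s i = length (filter (λ p → s p ≟ i) (allFin m))

-- k-Visits schedule: a sequence of length n*k (positions 0-based here),
-- each i occurs exactly k times, the first occurrence of i is within the
-- first d i positions, and each later occurrence of i is at most d i
-- positions after the previous occurrence.
record IsKVisitsSchedule (n k : ℕ) (d : Fin n → ℕ) (s : Fin (n * k) → Fin n) : Set where
  field
    exactly-k : ∀ i → count s i ≡ k
    first-within : ∀ (i : Fin n) (q : Fin (n * k)) → s q ≡ i →
      (∀ (p : Fin (n * k)) → toℕ p < toℕ q → ¬ (s p ≡ i)) →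
      suc (toℕ q) ≤ d i
    gap-within : ∀ (i : Fin n) (p q : Fin (n * k)) → s p ≡ i → s q ≡ i →
      toℕ p < toℕ q →
      (∀ (r : Fin (n * k)) → toℕ p < toℕ r → toℕ r < toℕ q → ¬ (s r ≡ i)) →
      toℕ q ≤ toℕ p + d i

HasKVisitsSchedule : (n k : ℕ) → (Fin n → ℕ) → Set
HasKVisitsSchedule n k d = ∃ (IsKVisitsSchedule n k d)

{-# OPTIONS --safe #-}
module Submission where

-- Visit the n jobs in consecutive blocks of k, job i occupying positions ik, …, ik + k − 1 (the map
-- p ↦ ⌊p/k⌋, i.e. quotient k). Every visit to i then happens before position (i+1)k, so deadlines
-- d_i = (i+1)k are met, while Dens = H_n / k is unbounded: doubling n adds at least n · 1/(2nk) = 1/(2k),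
-- so n = 2^m already gives density at least m/(2k).

open import Defs
open import Data.Nat using (ℕ; zero; suc; _+_; _*_; _^_; _≤_; z≤n; s≤s; NonZero)
import Data.Nat as ℕ
import Data.Nat.Properties as ℕ
open import Data.Nat.Tactic.RingSolver using (solve-∀)
open import Data.Bool using (true; false; if_then_else_)
open import Data.Fin using (Fin; toℕ; quotient; remainder; combine; _↑ˡ_; _↑ʳ_)
import Data.Fin as Fin
open import Data.Fin.Properties using (_≟_; toℕ<n; suc-injective; splitAt-↑ˡ; splitAt-↑ʳ; combine-remQuot; toℕ-combine)
open import Data.List using ([]; _∷_; map; filter; length; tabulate)
open import Data.List.Properties using (map-tabulate; filter-≐; filter-all; filter-none; length-tabulate)
open import Data.List.Relation.Unary.All.Properties using (tabulate⁺)
open import Data.Integer using (+_)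
import Data.Integer as ℤ
import Data.Integer.Properties as ℤ
import Data.Integer.Tactic.RingSolver as ℤ-Solver
open import Data.Rational using (ℚ; 0ℚ; mkℚ; _/_; _<_; ↥_; toℚᵘ)
import Data.Rational as ℚ
import Data.Rational.Properties as ℚ
open import Data.Rational.Unnormalised using (mkℚᵘ; *≤*; *<*; *≡*) renaming (_+_ to _+ᵘ_)
import Data.Rational.Unnormalised.Properties as ℚᵘ
open import Data.Product using (Σ; ∃; _×_; _,_)
open import Function using (_∘_; id)
open import Relation.Nullary using (does)
open import Relation.Unary using (Decidable; _≐_)
open import Relation.Binary.PropositionalEquality

private variable
  A B : Set
  m n : ℕ

length-filter-map : ∀ {P : B → Set} (P? : Decidable P) (f : A → B) xs →
  length (filter P? (map f xs)) ≡ length (filter (P? ∘ f) xs)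
length-filter-map P? f [] = refl
length-filter-map P? f (x ∷ xs) with does (P? (f x))
... | true  = cong suc (length-filter-map P? f xs)
... | false = length-filter-map P? f xs

count-tail : (s : Fin (suc m) → Fin n) (i : Fin n) →
  length (filter (λ p → s p ≟ i) (tabulate Fin.suc)) ≡ count (s ∘ Fin.suc) i
count-tail {m} s i = begin
  length (filter Q? (tabulate Fin.suc))        ≡⟨ cong (length ∘ filter Q?) (map-tabulate id Fin.suc) ⟨
  length (filter Q? (map Fin.suc (allFin m)))  ≡⟨ length-filter-map Q? Fin.suc (allFin m) ⟩
  count (s ∘ Fin.suc) i                        ∎
  where
  open ≡-Reasoning
  Q? = λ p → s p ≟ i

count-suc : (s : Fin (suc m) → Fin n) (i : Fin n) →
  count s i ≡ (if does (s Fin.zero ≟ i) then 1 else 0) + count (s ∘ Fin.suc) i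
count-suc s i with tail ← count-tail s i | does (s Fin.zero ≟ i)
... | true  = cong suc tail
... | false = tail

count-↑ : ∀ a {b} (s : Fin (a + b) → Fin n) (i : Fin n) →
  count s i ≡ count (s ∘ (_↑ˡ b)) i + count (s ∘ (a ↑ʳ_)) i
count-↑ zero    s i = refl
count-↑ (suc a) {b} s i = begin
  count s i                      ≡⟨ count-suc s i ⟩
  here + count (s ∘ Fin.suc) i   ≡⟨ cong (λ c → here + c) (count-↑ a (s ∘ Fin.suc) i) ⟩
  here + (left + right)          ≡⟨ ℕ.+-assoc here left right ⟨
  here + left + right            ≡⟨ cong (_+ right) (count-suc (s ∘ (_↑ˡ b)) i) ⟨
  count (s ∘ (_↑ˡ b)) i + right  ∎
  where
  open ≡-Reasoning
  here  = if does (s Fin.zero ≟ i) then 1 else 0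
  left  = count (s ∘ Fin.suc ∘ (_↑ˡ b)) i
  right = count (s ∘ (suc a ↑ʳ_)) i

count-≐ : ∀ {n′} {s : Fin m → Fin n} {t : Fin m → Fin n′} {i : Fin n} {j : Fin n′} →
  (λ p → s p ≡ i) ≐ (λ p → t p ≡ j) → count s i ≡ count t j
count-≐ {m} {s = s} {t} {i} {j} s≐t =
  cong length (filter-≐ (λ p → s p ≟ i) (λ p → t p ≟ j) s≐t (allFin m))

count-all : (s : Fin m → Fin n) (i : Fin n) → (∀ p → s p ≡ i) → count s i ≡ m
count-all {m} s i all≡ =
  trans (cong length (filter-all (λ p → s p ≟ i) (tabulate⁺ all≡))) (length-tabulate id)

count-none : (s : Fin m → Fin n) (i : Fin n) → (∀ p → s p ≢ i) → count s i ≡ 0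
count-none {m} s i all≢ = cong length (filter-none (λ p → s p ≟ i) (tabulate⁺ all≢))

count-cong : {s t : Fin m → Fin n} (i : Fin n) → (∀ p → s p ≡ t p) → count s i ≡ count t i
count-cong {s = s} {t} i s≗t =
  count-≐ {s = s} {t = t} ((λ {p} → trans (sym (s≗t p))) , (λ {p} → trans (s≗t p)))

count-∘suc : (s : Fin m → Fin n) (i : Fin n) → count (Fin.suc ∘ s) (Fin.suc i) ≡ count s i
count-∘suc s i = count-≐ {s = Fin.suc ∘ s} {t = s} (suc-injective , cong Fin.suc)

quotient-↑ˡ : ∀ k (j : Fin k) → quotient {suc n} k (j ↑ˡ n * k) ≡ Fin.zero
quotient-↑ˡ {n} k j rewrite splitAt-↑ˡ k j (n * k) = refl

quotient-↑ʳ : ∀ k (j : Fin (n * k)) → quotient {suc n} k (k ↑ʳ j) ≡ Fin.suc (quotient k j)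
quotient-↑ʳ {n} k j rewrite splitAt-↑ʳ k (n * k) j = refl

count-quotient : ∀ k (i : Fin n) → count (quotient {n} k) i ≡ k
count-quotient {suc n} k i = begin
  count (quotient k) i                                                 ≡⟨ count-↑ k (quotient k) i ⟩
  count (quotient k ∘ (_↑ˡ n * k)) i + count (quotient k ∘ (k ↑ʳ_)) i
    ≡⟨ cong₂ _+_ (count-cong i (quotient-↑ˡ k)) (count-cong i (quotient-↑ʳ k)) ⟩
  count first i + count rest i                                         ≡⟨ blocks i ⟩
  k                                                                    ∎
  where
  open ≡-Reasoning
  first : Fin k → Fin (suc n)
  first _ = Fin.zero
  rest : Fin (n * k) → Fin (suc n)
  rest = Fin.suc ∘ quotient k
  blocks : ∀ i → count first i + count rest i ≡ k
  blocks Fin.zero    = trans (cong₂ _+_ (count-all first Fin.zero λ _ → refl)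
                                         (count-none rest Fin.zero λ _ ()))
                             (ℕ.+-identityʳ k)
  blocks (Fin.suc i) = cong₂ _+_ (count-none first (Fin.suc i) λ _ ())
                                 (trans (count-∘suc (quotient {n} k) i) (count-quotient k i))

blockDeadline : ℕ → Fin n → ℕ
blockDeadline k i = suc (toℕ i) * k

toℕ<blockDeadline-quotient : ∀ k (p : Fin (n * k)) → toℕ p ℕ.< blockDeadline k (quotient {n} k p)
toℕ<blockDeadline-quotient {n} k p = begin-strict
  toℕ p                                  ≡⟨ cong toℕ (combine-remQuot {n} k p) ⟨
  toℕ (combine q (remainder {n} k p))    ≡⟨ toℕ-combine q (remainder {n} k p) ⟩
  k * toℕ q + toℕ (remainder {n} k p)    <⟨ ℕ.+-monoʳ-< (k * toℕ q) (toℕ<n (remainder {n} k p)) ⟩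
  k * toℕ q + k                          ≡⟨ end-of-block (toℕ q) k ⟩
  suc (toℕ q) * k                        ∎
  where
  open ℕ.≤-Reasoning
  q = quotient {n} k p
  end-of-block : ∀ t k → k * t + k ≡ suc t * k
  end-of-block = solve-∀

withinDeadlines⇒isKVisitsSchedule : ∀ {k} {d : Fin n → ℕ} {s : Fin (n * k) → Fin n} →
  (∀ i → count s i ≡ k) → (∀ p → toℕ p ℕ.< d (s p)) → IsKVisitsSchedule n k d s
withinDeadlines⇒isKVisitsSchedule {d = d} {s} count≡k p<d = record
  { exactly-k    = count≡k
  ; first-within = λ i q sq≡i _ → visit<deadline q sq≡i
  ; gap-within   = λ i p q _ sq≡i _ _ → ℕ.≤-trans (ℕ.<⇒≤ (visit<deadline q sq≡i)) (ℕ.m≤n+m _ (toℕ p))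
  }
  where
  visit<deadline : ∀ q {i} → s q ≡ i → toℕ q ℕ.< d i
  visit<deadline q refl = p<d q

quotient-isKVisitsSchedule : ∀ n k → IsKVisitsSchedule n k (blockDeadline k) (quotient {n} k)
quotient-isKVisitsSchedule n k =
  withinDeadlines⇒isKVisitsSchedule (count-quotient k) (toℕ<blockDeadline-quotient {n} k)

+/-mono-≤ : ∀ a b c d .{{_ : NonZero b}} .{{_ : NonZero d}} → a * d ℕ.≤ c * b → + a / b ℚ.≤ + c / d
+/-mono-≤ a b@(suc b-1) c d@(suc d-1) ad≤cb = ℚ.toℚᵘ-cancel-≤ (begin
  toℚᵘ (+ a / b)  ≃⟨ ℚ.toℚᵘ-fromℚᵘ (mkℚᵘ (+ a) b-1) ⟩
  mkℚᵘ (+ a) b-1  ≤⟨ *≤* (subst₂ ℤ._≤_ (ℤ.pos-* a d) (ℤ.pos-* c b) (ℤ.+≤+ ad≤cb)) ⟩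
  mkℚᵘ (+ c) d-1  ≃⟨ ℚ.toℚᵘ-fromℚᵘ (mkℚᵘ (+ c) d-1) ⟨
  toℚᵘ (+ c / d)  ∎)
  where open ℚᵘ.≤-Reasoning

+/-cong : ∀ a b c d .{{_ : NonZero b}} .{{_ : NonZero d}} → a * d ≡ c * b → + a / b ≡ + c / d
+/-cong a b c d ad≡cb =
  ℚ.≤-antisym (+/-mono-≤ a b c d (ℕ.≤-reflexive ad≡cb)) (+/-mono-≤ c d a b (ℕ.≤-reflexive (sym ad≡cb)))

common-denominator : ∀ x y z → (x ℤ.* z ℤ.+ y ℤ.* z) ℤ.* z ≡ (x ℤ.+ y) ℤ.* (z ℤ.* z)
common-denominator = ℤ-Solver.solve-∀

+/-+ : ∀ a b d .{{_ : NonZero d}} → + a / d ℚ.+ + b / d ≡ + (a + b) / d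
+/-+ a b d@(suc d-1) = ℚ.toℚᵘ-injective (begin-equality
  toℚᵘ (+ a / d ℚ.+ + b / d)          ≃⟨ ℚ.toℚᵘ-homo-+ (+ a / d) (+ b / d) ⟩
  toℚᵘ (+ a / d) +ᵘ toℚᵘ (+ b / d)  ≃⟨ ℚᵘ.+-cong (ℚ.toℚᵘ-fromℚᵘ (mkℚᵘ (+ a) d-1))
                                                   (ℚ.toℚᵘ-fromℚᵘ (mkℚᵘ (+ b) d-1)) ⟩
  mkℚᵘ (+ a) d-1 +ᵘ mkℚᵘ (+ b) d-1  ≃⟨ *≡* (trans (common-denominator (+ a) (+ b) (+ d))
                                                     (cong (ℤ._* (+ d ℤ.* + d)) (sym (ℤ.pos-+ a b)))) ⟩
  mkℚᵘ (+ (a + b)) d-1                ≃⟨ ℚ.toℚᵘ-fromℚᵘ (mkℚᵘ (+ (a + b)) d-1) ⟨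
  toℚᵘ (+ (a + b) / d)                ∎)
  where open ℚᵘ.≤-Reasoning

sumFin-+ : ∀ a b (g : ℕ → ℚ) →
  sumFin (a + b) (g ∘ toℕ) ≡ sumFin a (g ∘ toℕ) ℚ.+ sumFin b (λ j → g (a + toℕ j))
sumFin-+ zero    b g = sym (ℚ.+-identityˡ _)
sumFin-+ (suc a) b g = trans (cong (g 0 ℚ.+_) (sumFin-+ a b (g ∘ suc))) (sym (ℚ.+-assoc (g 0) _ _))

sumFin-mono-≤ : {f g : Fin n → ℚ} → (∀ i → f i ℚ.≤ g i) → sumFin n f ℚ.≤ sumFin n g
sumFin-mono-≤ {zero}  f≤g = ℚ.≤-refl
sumFin-mono-≤ {suc n} f≤g = ℚ.+-mono-≤ (f≤g Fin.zero) (sumFin-mono-≤ (f≤g ∘ Fin.suc))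

sumFin-nonNeg : {f : Fin n → ℚ} → (∀ i → 0ℚ ℚ.≤ f i) → 0ℚ ℚ.≤ sumFin n f
sumFin-nonNeg {zero}  0≤f = ℚ.≤-refl
sumFin-nonNeg {suc n} 0≤f = ℚ.+-mono-≤ (0≤f Fin.zero) (sumFin-nonNeg (0≤f ∘ Fin.suc))

inv≡1/ : ∀ d .{{_ : NonZero d}} → inv d ≡ + 1 / d
inv≡1/ (suc d) = refl

inv-nonNeg : ∀ d → 0ℚ ℚ.≤ inv d
inv-nonNeg zero    = ℚ.≤-refl
inv-nonNeg (suc d) = +/-mono-≤ 0 1 1 (suc d) z≤n

Dens-nonNeg : ∀ n (d : Fin n → ℕ) → 0ℚ ℚ.≤ Dens n d
Dens-nonNeg n d = sumFin-nonNeg (inv-nonNeg ∘ d)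

inv-antimono-≤ : ∀ {a b} .{{_ : NonZero a}} → a ≤ b → inv b ℚ.≤ inv a
inv-antimono-≤ {suc a} {suc b} a≤b = +/-mono-≤ 1 (suc b) 1 (suc a) (ℕ.*-monoʳ-≤ 1 a≤b)

sumFin-const-inv : ∀ n d .{{_ : NonZero d}} → sumFin n (λ _ → inv d) ≡ + n / d
sumFin-const-inv zero    d = sym (ℚ.0/n≡0 d)
sumFin-const-inv (suc n) d = begin
  inv d ℚ.+ sumFin n (λ _ → inv d) ≡⟨ cong₂ ℚ._+_ (inv≡1/ d) (sumFin-const-inv n d) ⟩
  + 1 / d ℚ.+ + n / d              ≡⟨ +/-+ 1 n d ⟩
  + suc n / d                      ∎
  where open ≡-Reasoning

Dens-blockDeadline-double : ∀ k .{{_ : NonZero k}} P .{{_ : NonZero P}} →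
  Dens P (blockDeadline k) ℚ.+ inv (2 * k) ℚ.≤ Dens (P + P) (blockDeadline k)
Dens-blockDeadline-double k P = begin
  H P ℚ.+ inv (2 * k)                                 ≡⟨ cong (H P ℚ.+_) (inv≡1/ (2 * k)) ⟩
  H P ℚ.+ + 1 / (2 * k)                               ≡⟨ cong (H P ℚ.+_) (+/-cong 1 (2 * k) P D (ℕ.*-identityˡ D)) ⟩
  H P ℚ.+ + P / D                                     ≡⟨ cong (H P ℚ.+_) (sumFin-const-inv P D) ⟨
  H P ℚ.+ sumFin P (λ _ → inv D)                      ≤⟨ ℚ.+-monoʳ-≤ (H P) (sumFin-mono-≤ later≥) ⟩
  H P ℚ.+ sumFin P (λ j → inv (suc (P + toℕ j) * k))  ≡⟨ sumFin-+ P P (λ i → inv (suc i * k)) ⟨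
  H (P + P)                                           ∎
  where
  open ℚ.≤-Reasoning
  H : ℕ → ℚ
  H n = Dens n (blockDeadline k)
  D = P * (2 * k)
  instance
    2k≢0 : NonZero (2 * k)
    2k≢0 = ℕ.m*n≢0 2 k
    D≢0 : NonZero D
    D≢0 = ℕ.m*n≢0 P (2 * k)
  double : ∀ P k → (P + P) * k ≡ P * (2 * k)
  double = solve-∀
  later≥ : ∀ j → inv D ℚ.≤ inv (suc (P + toℕ j) * k)
  later≥ j = inv-antimono-≤ {{ℕ.m*n≢0 (suc (P + toℕ j)) k}}
    (ℕ.≤-trans (ℕ.*-monoˡ-≤ k (ℕ.+-monoʳ-< P (toℕ<n j))) (ℕ.≤-reflexive (double P k)))

Dens-blockDeadline-2^ : ∀ k .{{_ : NonZero k}} m → Dens m (λ _ → 2 * k) ℚ.≤ Dens (2 ^ m) (blockDeadline k)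
Dens-blockDeadline-2^ k zero    = Dens-nonNeg 1 (blockDeadline k)
Dens-blockDeadline-2^ k (suc m) = begin
  inv (2 * k) ℚ.+ Dens m (λ _ → 2 * k) ≤⟨ ℚ.+-monoʳ-≤ (inv (2 * k)) (Dens-blockDeadline-2^ k m) ⟩
  inv (2 * k) ℚ.+ H P                  ≡⟨ ℚ.+-comm (inv (2 * k)) (H P) ⟩
  H P ℚ.+ inv (2 * k)                  ≤⟨ Dens-blockDeadline-double k P {{ℕ.m^n≢0 2 m}} ⟩
  H (P + P)                            ≡⟨ cong (λ Q → H (P + Q)) (ℕ.+-identityʳ P) ⟨
  H (2 ^ suc m)                        ∎
  where
  open ℚ.≤-Reasoning
  P = 2 ^ m
  H : ℕ → ℚ
  H n = Dens n (blockDeadline k)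

i≤+∣i∣ : ∀ i → i ℤ.≤ + ℤ.∣ i ∣
i≤+∣i∣ (+ n)      = ℤ.≤-refl
i≤+∣i∣ ℤ.-[1+ n ] = ℤ.-≤+

i*1<[1+∣i∣]*[1+n] : ∀ i n → i ℤ.* + 1 ℤ.< + suc ℤ.∣ i ∣ ℤ.* + suc n
i*1<[1+∣i∣]*[1+n] i n = begin-strict
  i ℤ.* + 1                  ≡⟨ ℤ.*-identityʳ i ⟩
  i                          ≤⟨ i≤+∣i∣ i ⟩
  + ℤ.∣ i ∣                  <⟨ ℤ.+<+ (ℕ.n<1+n _) ⟩
  + suc ℤ.∣ i ∣              ≤⟨ ℤ.+≤+ (ℕ.m≤m*n (suc ℤ.∣ i ∣) (suc n)) ⟩
  + (suc ℤ.∣ i ∣ * suc n)    ≡⟨ ℤ.pos-* (suc ℤ.∣ i ∣) (suc n) ⟩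
  + suc ℤ.∣ i ∣ ℤ.* + suc n  ∎
  where open ℤ.≤-Reasoning

p<suc∣↥p∣/1 : ∀ p → p < + suc ℤ.∣ ↥ p ∣ / 1
p<suc∣↥p∣/1 (mkℚ num den-1 _) = ℚ.toℚᵘ-cancel-< (begin-strict
  mkℚᵘ num den-1                <⟨ *<* (i*1<[1+∣i∣]*[1+n] num den-1) ⟩
  mkℚᵘ (+ suc ℤ.∣ num ∣) 0      ≃⟨ ℚ.toℚᵘ-fromℚᵘ (mkℚᵘ (+ suc ℤ.∣ num ∣) 0) ⟨
  toℚᵘ (+ suc ℤ.∣ num ∣ / 1)    ∎)
  where open ℚᵘ.≤-Reasoning

Dens-blockDeadline-unbounded : ∀ k .{{_ : NonZero k}} (δ : ℚ) → ∃ λ m → δ < Dens (2 ^ m) (blockDeadline k)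
Dens-blockDeadline-unbounded k δ = M , ℚ.<-≤-trans (p<suc∣↥p∣/1 δ) (begin
  + c / 1                     ≡⟨ +/-cong c 1 M (2 * k) (sym (ℕ.*-identityʳ M)) ⟩
  + M / (2 * k)               ≡⟨ sumFin-const-inv M (2 * k) ⟨
  Dens M (λ _ → 2 * k)        ≤⟨ Dens-blockDeadline-2^ k M ⟩
  Dens (2 ^ M) (blockDeadline k) ∎)
  where
  open ℚ.≤-Reasoning
  instance
    2k≢0 : NonZero (2 * k)
    2k≢0 = ℕ.m*n≢0 2 k
  c = suc ℤ.∣ ↥ δ ∣
  M = c * (2 * k)

theorem13 : (k : ℕ) → 1 ≤ k → (δ : ℚ) → 0ℚ < δ →
    ∃ λ (n : ℕ) → Σ (Fin n → ℕ) λ d →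
      Positive n d × δ < Dens n d × HasKVisitsSchedule n k d
theorem13 k@(suc _) _ δ _ =
  let m , δ<Dens = Dens-blockDeadline-unbounded k δ in
  2 ^ m , blockDeadline k , (λ _ → s≤s z≤n) , δ<Dens , quotient k , quotient-isKVisitsSchedule (2 ^ m) k
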